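{- Let $X$ be a set with $n\ge4$ elements and $\mathcal{S}$ a linearly independent split system on $X$. If $\mathcal{S}$ is orderly, then $\mathcal{S}$ is closed.
   Context: A distance on $X$ is a symmetric map $D:X\times X\to\mathbb{R}$ with $D(x,x)=0$, $D(x,y)\ge0$. A split of $X$ is a bipartition $\{A,B\}$ into two non-empty sets, written $A|B$; a split system on $X$ is a non-empty set of splits. For a split $S=A|B$, $D_S(x,y)=1$ if exactly one of $x,y$ lies in $A$ and $0$ otherwise; for a weighting $\omega:\mathcal{S}\to\mathbb{R}_{\ge0}$, $D_{(\mathcal{S},\omega)}=\sum_{S\in\mathcal{S}}\omega(S)D_S$. For a distance $D$ and $u\ne v$ let $X_{u,v}=\{x: D(u,x)<D(v,x)\}$, $E_{\{u,v\}}=\{x: D(u,x)=D(v,x)\}$, and for $q\ge\frac p2>0$ $$O_{p,q}(D)=\sum_{\substack{(u,v),\ u\neq v\\ \emptyset\subsetneq X_{u,v}\subsetneq X}}\tfrac{p}{2} D_{X_{u,v}|X-X_{u,v}}+\sum_{\substack{\{u,v\},\ u\ne v\\ \emptyset\subsetneq E_{\{u,v\}}\subsetneq X}}\left(q-\tfrac p2\right)D_{E_{\{u,v\}}|X-E_{\{u,v\}}}.$$ A split system $\mathcal{S}$ is orderly if for all $q=\frac p2>0$ and every non-negative weighting $\omega$ of $\mathcal{S}$ there is a non-negative weighting $\omega'$ of $\mathcal{S}$ with $O_{p,q}(D_{(\mathcal{S},\omega)})=D_{(\mathcal{S},\omega')}$. $\mathcal{S}$ is linearly independent if $\{D_S: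 S\in\mathcal{S}\}$ is linearly independent in the real vector space of symmetric maps $X\times X\to\mathbb{R}$ vanishing on the diagonal. Two splits $A_1|B_1$, $A_2|B_2$ are incompatible if all four of $A_1\cap A_2$, $A_1\cap B_2$, $B_1\cap A_2$, $B_1\cap B_2$ are non-empty. $\mathcal{S}$ is closed if for any two incompatible splits $A_1|B_1, A_2|B_2\in\mathcal{S}$ at least one of the following holds: (a) $\mathcal{S}$ contains the splits $A_1\cap A_2|X-(A_1\cap A_2)$, $B_1\cap A_2|X-(B_1\cap A_2)$, $A_1\cap B_2|X-(A_1\cap B_2)$ and $B_1\cap B_2|X-(B_1\cap B_2)$; (b) $|A_1\cap A_2|\cdot|B_1\cap B_2|=|A_1\cap B_2|\cdot|B_1\cap A_2|$ and $\mathcal{S}$ contains $(A_1\cap A_2)\cup(B_1\cap B_2)|(A_1\cap B_2)\cup(B_1\cap A_2)$; (c) $|A_1\cap A_2|\cdot|B_1\cap B_2|>|A_1\cap B_2|\cdot|B_1\cap A_2|$ and $\mathcal{S}$ contains $(A_1\cap A_2)\cup(B_1\cap B_2)|(A_1\cap B_2)\cup(B_1\cap A_2)$, $A_1\cap A_2|X-(A_1\cap A_2)$ and $B_1\cap B_2|X-(B_1\cap B_2)$; (d) $|A_1\cap A_2|\cdot|B_1\cap B_2|<|A_1\cap B_2|\cdot|B_1\cap A_2|$ and $\mathcal{S}$ contains $(A_1\cap A_2)\cup(B_1\cap B_2)|(A_1\cap B_2)\cup(B_1\cap A_2)$, $B_1\cap A_2|X-(B_1\cap A_2)$ and $A_1\cap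 B_2|X-(A_1\cap B_2)$.
   Formalization: The weightings ω and ω', the parameters p and q, and the coefficients in linear independence are rational rather than real. -}

module Defs where

open import Data.Bool using (Bool; true; false; not; _∧_; _∨_; _xor_; if_then_else_)
open import Data.Nat as ℕ using (ℕ; zero; suc)
open import Data.Fin using (Fin; zero; suc; toℕ)
open import Data.Fin.Subset using (Subset; _∈_; ∁; _∩_; _∪_; ∣_∣; Nonempty)
open import Data.Vec using (lookup; tabulate)
open import Data.Rational using (ℚ; 0ℚ; 1ℚ; ½; _+_; _*_; _-_; _≤_; _<_; _≤ᵇ_)
open import Data.Rational.Properties using (_≟_)
open import Data.Product using (Σ; ∃; _×_; _,_)
open import Data.Sum using (_⊎_)
open import Relation.Nullary using (does)
open import Relation.Binary.PropositionalEquality using (_≡_)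

Σℚ : (m : ℕ) → (Fin m → ℚ) → ℚ
Σℚ zero    f = 0ℚ
Σℚ (suc m) f = f zero + Σℚ m (λ i → f (suc i))

[_]ℚ : Bool → ℚ
[ true  ]ℚ = 1ℚ
[ false ]ℚ = 0ℚ

-- distances on X: symmetric maps X × X → ℚ (only used as functions here)
Dist : ℕ → Set
Dist n = Fin n → Fin n → ℚ

IsSplit : {n : ℕ} → Subset n → Set
IsSplit A = Nonempty A × Nonempty (∁ A)

properᵇ : {n : ℕ} → Subset n → Bool
properᵇ {n} A = anyᵇ n (lookup A) ∧ not (allᵇ n (lookup A))
  where
  anyᵇ : (k : ℕ) → (Fin k → Bool) → Bool
  anyᵇ zero    f = false
  anyᵇ (suc k) f = f zero ∨ anyᵇ k (λ i → f (suc i))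
  allᵇ : (k : ℕ) → (Fin k → Bool) → Bool
  allᵇ zero    f = true
  allᵇ (suc k) f = f zero ∧ allᵇ k (λ i → f (suc i))

D[_] : {n : ℕ} → Subset n → Dist n
D[ A ] x y = [ lookup A x xor lookup A y ]ℚ

-- a split system with m splits, given by one side of each split
SplitSystem : ℕ → ℕ → Set
SplitSystem n m = Fin m → Subset n

IsSplitSystem : {n m : ℕ} → SplitSystem n m → Set
IsSplitSystem {n} {m} S = (0 ℕ.< m) × ((i : Fin m) → IsSplit (S i))

D⟨_,_⟩ : {n m : ℕ} → SplitSystem n m → (Fin m → ℚ) → Dist n
D⟨_,_⟩ {n} {m} S ω x y = Σℚ m (λ i → ω i * D[ S i ] x y)

Xuv : {n : ℕ} → Dist n → Fin n → Fin n → Subset n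
Xuv D u v = tabulate (λ x → not (D v x ≤ᵇ D u x))

Euv : {n : ℕ} → Dist n → Fin n → Fin n → Subset n
Euv D u v = tabulate (λ x → does (D u x ≟ D v x))

_≠ᵇ_ : {n : ℕ} → Fin n → Fin n → Bool
u ≠ᵇ v = not (toℕ u ℕ.≡ᵇ toℕ v)

_<ᵇF_ : {n : ℕ} → Fin n → Fin n → Bool
u <ᵇF v = toℕ u ℕ.<ᵇ toℕ v

-- O_{p,q}(D): first sum over ordered pairs (u,v), u ≠ v; second over
-- unordered pairs {u,v}, u ≠ v (enumerated as u < v).
O : {n : ℕ} → ℚ → ℚ → Dist n → Dist n
O {n} p q D x y =
    Σℚ n (λ u → Σℚ n (λ v →
      [ (u ≠ᵇ v) ∧ properᵇ (Xuv D u v) ]ℚ * ((p * ½) * D[ Xuv D u v ] x y)))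
  + Σℚ n (λ u → Σℚ n (λ v →
      [ (u <ᵇF v) ∧ properᵇ (Euv D u v) ]ℚ * ((q - p * ½) * D[ Euv D u v ] x y)))

NonNeg : {m : ℕ} → (Fin m → ℚ) → Set
NonNeg {m} ω = (i : Fin m) → 0ℚ ≤ ω i

Orderly : {n m : ℕ} → SplitSystem n m → Set
Orderly {n} {m} S =
  (p q : ℚ) → q ≡ p * ½ → 0ℚ < q →
  (ω : Fin m → ℚ) → NonNeg ω →
  Σ (Fin m → ℚ) λ ω' → NonNeg ω' ×
    ((x y : Fin n) → O p q D⟨ S , ω ⟩ x y ≡ D⟨ S , ω' ⟩ x y)

LinearlyIndependent : {n m : ℕ} → SplitSystem n m → Set
LinearlyIndependent {n} {m} S =
  (c : Fin m → ℚ) → ((x y : Fin n) → D⟨ S , c ⟩ x y ≡ 0ℚ) → (i : Fin m) → c i ≡ 0ℚ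

Contains : {n m : ℕ} → SplitSystem n m → Subset n → Set
Contains {n} {m} S C = ∃ λ (i : Fin m) → (S i ≡ C) ⊎ (S i ≡ ∁ C)

Incompatible : {n : ℕ} → Subset n → Subset n → Set
Incompatible A₁ A₂ =
  Nonempty (A₁ ∩ A₂) × Nonempty (A₁ ∩ ∁ A₂) ×
  Nonempty (∁ A₁ ∩ A₂) × Nonempty (∁ A₁ ∩ ∁ A₂)

module _ {n m : ℕ} (S : SplitSystem n m) (A₁ A₂ : Subset n) where
  private
    B₁ = ∁ A₁
    B₂ = ∁ A₂
    P = ∣ A₁ ∩ A₂ ∣ ℕ.* ∣ B₁ ∩ B₂ ∣
    Q = ∣ A₁ ∩ B₂ ∣ ℕ.* ∣ B₁ ∩ A₂ ∣
    diag = (A₁ ∩ A₂) ∪ (B₁ ∩ B₂)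

  CondA CondB CondC CondD : Set
  CondA = Contains S (A₁ ∩ A₂) × Contains S (B₁ ∩ A₂) ×
          Contains S (A₁ ∩ B₂) × Contains S (B₁ ∩ B₂)
  CondB = P ≡ Q × Contains S diag
  CondC = Q ℕ.< P × Contains S diag × Contains S (A₁ ∩ A₂) × Contains S (B₁ ∩ B₂)
  CondD = P ℕ.< Q × Contains S diag × Contains S (B₁ ∩ A₂) × Contains S (A₁ ∩ B₂)

Closed : {n m : ℕ} → SplitSystem n m → Set
Closed {n} {m} S = (i j : Fin m) → Incompatible (S i) (S j) →
  CondA S (S i) (S j) ⊎ CondB S (S i) (S j) ⊎ CondC S (S i) (S j) ⊎ CondD S (S i) (S j)

-- Let A₁|B₁ and A₂|B₂ be incompatible splits in S and D = D_{A₁|B₁} + D_{A₂|B₂}.  Orderliness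
-- (p = 2, q = 1) gives O(D) = Σ ω_S D_S with ω ≥ 0.  D is the Hamming distance between the blocks
-- A₁∩A₂, A₁∩B₂, B₁∩A₂, B₁∩B₂ of its arguments, so O(D) vanishes inside blocks and every split of
-- positive weight is a union of blocks.  For x in one block and y, z in the two neighbouring ones,
-- X_{u,v} separates x from y and z exactly when u lies in the block of x and v in the opposite
-- block.  Evaluating O(x,y) + O(x,z) − O(y,z) both ways therefore gives, for every block,
--   |block| · |opposite block| = (weight of the split cutting off the block) + d,
-- with d the weight of the diagonal split (A₁∩A₂)∪(B₁∩B₂) | (A₁∩B₂)∪(B₁∩A₂).  If d = 0 all four
-- corner splits have positive weight (a); otherwise comparing |A₁∩A₂||B₁∩B₂| with |A₁∩B₂||B₁∩A₂|
-- shows which corner weights exceed d, giving (b), (c) or (d).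

module Submission where

open import Defs
open import Algebra.Bundles using (CommutativeMonoid)
open import Data.Bool using (Bool; true; false; not; _∧_; _∨_; _xor_)
open import Data.Bool.Properties using (not-involutive; xor-same; ¬-not; not-distribˡ-xor; not-distribʳ-xor)
open import Data.Empty using (⊥-elim)
open import Data.Fin using (Fin; zero; suc; toℕ)
open import Data.Fin.Properties using (toℕ-injective) renaming (_≟_ to _≟F_)
open import Data.Fin.Subset using (Subset; _∈_; ∁; _∩_; _∪_; ∣_∣; Nonempty)
open import Data.Fin.Subset.Properties using (x∈p∩q⁻; x∈∁p⇒x∉p; x∈p⇒∣p-x∣<∣p∣)
open import Data.Nat using (ℕ; zero; suc; _≤_)
import Data.Nat as ℕ
import Data.Nat.Properties as ℕP
open import Data.Product using (∃; _×_; _,_; proj₁; proj₂)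
open import Data.Rational using (ℚ; 0ℚ; 1ℚ; ½; _+_; _*_; _-_; _<_; _<?_; _≤ᵇ_) renaming (_≤_ to _≤ℚ_)
import Data.Rational.Properties as ℚP
open import Data.Rational.Solver using (module +-*-Solver)
open import Data.Sum using (_⊎_; inj₁; inj₂)
open import Data.Vec using ([]; _∷_; lookup)
open import Data.Vec.Properties
  using (lookup∘tabulate; lookup-zipWith; lookup-map; tabulate∘lookup; tabulate-cong; []=⇒lookup; lookup⇒[]=)
open import Function using (_∘_)
open import Relation.Binary.Definitions using (tri<; tri≈; tri>)
open import Relation.Binary.PropositionalEquality
open import Relation.Nullary using (yes; no; does)
open import Relation.Nullary.Decidable using (dec-false)

open import Algebra.Properties.CommutativeSemigroup
  (CommutativeMonoid.commutativeSemigroup ℚP.+-0-commutativeMonoid)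
  using () renaming (interchange to +-interchange)
open +-*-Solver

-- Finite sums over ℚ

Σℚ-cong : ∀ m {f g : Fin m → ℚ} → (∀ k → f k ≡ g k) → Σℚ m f ≡ Σℚ m g
Σℚ-cong zero    f≗g = refl
Σℚ-cong (suc m) f≗g = cong₂ _+_ (f≗g zero) (Σℚ-cong m (f≗g ∘ suc))

Σℚ-zero : ∀ m {f : Fin m → ℚ} → (∀ k → f k ≡ 0ℚ) → Σℚ m f ≡ 0ℚ
Σℚ-zero zero    f≗0 = refl
Σℚ-zero (suc m) f≗0 = trans (cong₂ _+_ (f≗0 zero) (Σℚ-zero m (f≗0 ∘ suc))) (ℚP.+-identityˡ 0ℚ)

Σℚ-+ : ∀ m (f g : Fin m → ℚ) → Σℚ m (λ k → f k + g k) ≡ Σℚ m f + Σℚ m g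
Σℚ-+ zero    f g = refl
Σℚ-+ (suc m) f g = trans (cong (f zero + g zero +_) (Σℚ-+ m (f ∘ suc) (g ∘ suc)))
                         (+-interchange (f zero) (g zero) _ _)

Σℚ-*ˡ : ∀ m c (f : Fin m → ℚ) → Σℚ m (λ k → c * f k) ≡ c * Σℚ m f
Σℚ-*ˡ zero    c f = sym (ℚP.*-zeroʳ c)
Σℚ-*ˡ (suc m) c f = trans (cong (c * f zero +_) (Σℚ-*ˡ m c (f ∘ suc))) (sym (ℚP.*-distribˡ-+ c (f zero) _))

Σℚ-*ʳ : ∀ m c (f : Fin m → ℚ) → Σℚ m (λ k → f k * c) ≡ Σℚ m f * c
Σℚ-*ʳ m c f = trans (Σℚ-cong m (λ k → ℚP.*-comm (f k) c)) (trans (Σℚ-*ˡ m c f) (ℚP.*-comm c _))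

Σℚ-nonneg : ∀ m {f : Fin m → ℚ} → (∀ k → 0ℚ ≤ℚ f k) → 0ℚ ≤ℚ Σℚ m f
Σℚ-nonneg zero    f≥0 = ℚP.≤-refl
Σℚ-nonneg (suc m) f≥0 = ℚP.+-mono-≤ (f≥0 zero) (Σℚ-nonneg m (f≥0 ∘ suc))

nonneg-sum≡0⇒left≡0 : ∀ {a b} → 0ℚ ≤ℚ a → 0ℚ ≤ℚ b → a + b ≡ 0ℚ → a ≡ 0ℚ
nonneg-sum≡0⇒left≡0 {a} {b} a≥0 b≥0 a+b≡0 =
  ℚP.≤-antisym (subst₂ _≤ℚ_ (ℚP.+-identityʳ a) a+b≡0 (ℚP.+-monoʳ-≤ a b≥0)) a≥0

Σℚ-nonneg-≡0 : ∀ m {f : Fin m → ℚ} → (∀ k → 0ℚ ≤ℚ f k) → Σℚ m f ≡ 0ℚ → ∀ k → f k ≡ 0ℚ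
Σℚ-nonneg-≡0 (suc m) f≥0 Σ≡0 zero =
  nonneg-sum≡0⇒left≡0 (f≥0 zero) (Σℚ-nonneg m (f≥0 ∘ suc)) Σ≡0
Σℚ-nonneg-≡0 (suc m) {f} f≥0 Σ≡0 (suc k) =
  Σℚ-nonneg-≡0 m (f≥0 ∘ suc)
    (nonneg-sum≡0⇒left≡0 (Σℚ-nonneg m (f≥0 ∘ suc)) (f≥0 zero) (trans (ℚP.+-comm _ (f zero)) Σ≡0)) k

Σℚ-pos⇒∃ : ∀ m {f : Fin m → ℚ} → 0ℚ < Σℚ m f → ∃ λ k → 0ℚ < f k
Σℚ-pos⇒∃ zero Σ>0 = ⊥-elim (ℚP.<-irrefl refl Σ>0)
Σℚ-pos⇒∃ (suc m) {f} Σ>0 with 0ℚ <? f zero | 0ℚ <? Σℚ m (f ∘ suc)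
... | yes f₀>0 | _      = zero , f₀>0
... | no _     | yes Σ'>0 = let k , fk>0 = Σℚ-pos⇒∃ m Σ'>0 in suc k , fk>0
... | no f₀≯0  | no Σ'≯0  =
  ⊥-elim (ℚP.<-irrefl refl (ℚP.<-≤-trans Σ>0 (ℚP.+-mono-≤ (ℚP.≮⇒≥ f₀≯0) (ℚP.≮⇒≥ Σ'≯0))))

𝟙 : ∀ {m} → Fin m → Fin m → ℚ
𝟙 i k = [ does (k ≟F i) ]ℚ

Σℚ-𝟙 : ∀ m (i : Fin m) (f : Fin m → ℚ) → Σℚ m (λ k → 𝟙 i k * f k) ≡ f i
Σℚ-𝟙 (suc m) zero f =
  trans (cong₂ _+_ (ℚP.*-identityˡ (f zero)) (Σℚ-zero m (λ k → ℚP.*-zeroˡ (f (suc k)))))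
        (ℚP.+-identityʳ (f zero))
Σℚ-𝟙 (suc m) (suc i) f =
  trans (cong₂ _+_ (ℚP.*-zeroˡ (f zero)) (Σℚ-𝟙 m i (f ∘ suc))) (ℚP.+-identityˡ (f (suc i)))

0<1 : 0ℚ < 1ℚ
0<1 = ℚP.positive⁻¹ 1ℚ

[]-nonneg : ∀ b → 0ℚ ≤ℚ [ b ]ℚ
[]-nonneg true  = ℚP.<⇒≤ 0<1
[]-nonneg false = ℚP.≤-refl

*[]-nonneg : ∀ {w} → 0ℚ ≤ℚ w → ∀ b → 0ℚ ≤ℚ w * [ b ]ℚ
*[]-nonneg {w} w≥0 true  = subst (0ℚ ≤ℚ_) (sym (ℚP.*-identityʳ w)) w≥0
*[]-nonneg {w} w≥0 false = subst (0ℚ ≤ℚ_) (sym (ℚP.*-zeroʳ w)) ℚP.≤-refl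

*[]-pos : ∀ {w} b → 0ℚ < w * [ b ]ℚ → 0ℚ < w × b ≡ true
*[]-pos {w} true  w*1>0 = subst (0ℚ <_) (ℚP.*-identityʳ w) w*1>0 , refl
*[]-pos {w} false w*0>0 = ⊥-elim (ℚP.<-irrefl refl (subst (0ℚ <_) (ℚP.*-zeroʳ w) w*0>0))

*[]≡0 : ∀ {w} b → 0ℚ < w → w * [ b ]ℚ ≡ 0ℚ → b ≡ false
*[]≡0 false _ _ = refl
*[]≡0 {w} true w>0 w*1≡0 = ⊥-elim (ℚP.<-irrefl (sym (trans (sym (ℚP.*-identityʳ w)) w*1≡0)) w>0)

[]*-absorbs : ∀ {b c} k → (b ≡ true → c ≡ true) → [ c ]ℚ * (k * [ b ]ℚ) ≡ k * [ b ]ℚ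
[]*-absorbs {false} {c} k _ =
  trans (cong ([ c ]ℚ *_) (ℚP.*-zeroʳ k)) (trans (ℚP.*-zeroʳ [ c ]ℚ) (sym (ℚP.*-zeroʳ k)))
[]*-absorbs {true}      k b⇒c rewrite b⇒c refl = ℚP.*-identityˡ (k * 1ℚ)

two : ℚ
two = 1ℚ + 1ℚ

two*-injective : ∀ {a b} → two * a ≡ two * b → a ≡ b
two*-injective {a} {b} 2a≡2b = trans (sym (half a)) (trans (cong (½ *_) 2a≡2b) (half b))
  where
  half : ∀ x → ½ * (two * x) ≡ x
  half x = trans (sym (ℚP.*-assoc ½ two x)) (ℚP.*-identityˡ x)

summand-pos : ∀ {a s d} → a ≡ s + d → d < a → 0ℚ < s
summand-pos {a} {s} {d} a≡s+d d<a with 0ℚ <? s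
... | yes s>0 = s>0
... | no  s≯0 = ⊥-elim (ℚP.<-irrefl refl (ℚP.<-≤-trans d<a a≤d))
  where
  a≤d : a ≤ℚ d
  a≤d = subst₂ _≤ℚ_ (sym a≡s+d) (ℚP.+-identityˡ d) (ℚP.+-monoˡ-≤ d (ℚP.≮⇒≥ s≯0))

summand-bound : ∀ {a s d} → a ≡ s + d → 0ℚ ≤ℚ s → d ≤ℚ a
summand-bound {a} {s} {d} a≡s+d s≥0 = subst₂ _≤ℚ_ (ℚP.+-identityˡ d) (sym a≡s+d) (ℚP.+-monoˡ-≤ d s≥0)

toℚ : ℕ → ℚ
toℚ zero    = 0ℚ
toℚ (suc k) = 1ℚ + toℚ k

toℚ-+ : ∀ a b → toℚ (a ℕ.+ b) ≡ toℚ a + toℚ b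
toℚ-+ zero    b = sym (ℚP.+-identityˡ (toℚ b))
toℚ-+ (suc a) b = trans (cong (1ℚ +_) (toℚ-+ a b)) (sym (ℚP.+-assoc 1ℚ (toℚ a) (toℚ b)))

toℚ-* : ∀ a b → toℚ (a ℕ.* b) ≡ toℚ a * toℚ b
toℚ-* zero    b = sym (ℚP.*-zeroˡ (toℚ b))
toℚ-* (suc a) b = begin
  toℚ (b ℕ.+ a ℕ.* b)         ≡⟨ toℚ-+ b (a ℕ.* b) ⟩
  toℚ b + toℚ (a ℕ.* b)       ≡⟨ cong (toℚ b +_) (toℚ-* a b) ⟩
  toℚ b + toℚ a * toℚ b       ≡⟨ cong (_+ toℚ a * toℚ b) (sym (ℚP.*-identityˡ (toℚ b))) ⟩
  1ℚ * toℚ b + toℚ a * toℚ b  ≡⟨ sym (ℚP.*-distribʳ-+ (toℚ b) 1ℚ (toℚ a)) ⟩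
  (1ℚ + toℚ a) * toℚ b        ∎
  where open ≡-Reasoning

toℚ-nonneg : ∀ a → 0ℚ ≤ℚ toℚ a
toℚ-nonneg zero    = ℚP.≤-refl
toℚ-nonneg (suc a) = ℚP.+-mono-≤ ([]-nonneg true) (toℚ-nonneg a)

toℚ-mono-≤ : ∀ {a b} → a ≤ b → toℚ a ≤ℚ toℚ b
toℚ-mono-≤ {b = b} ℕ.z≤n = toℚ-nonneg b
toℚ-mono-≤ (ℕ.s≤s a≤b)   = ℚP.+-monoʳ-≤ 1ℚ (toℚ-mono-≤ a≤b)

toℚ-mono-< : ∀ {a b} → a ℕ.< b → toℚ a < toℚ b
toℚ-mono-< {a} a<b = ℚP.<-≤-trans a<1+a (toℚ-mono-≤ a<b)
  where
  a<1+a : toℚ a < 1ℚ + toℚ a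
  a<1+a = subst (_< 1ℚ + toℚ a) (ℚP.+-identityˡ (toℚ a)) (ℚP.+-monoˡ-< (toℚ a) 0<1)

Σℚ-[lookup]≡∣∣ : ∀ {n} (C : Subset n) → Σℚ n (λ u → [ lookup C u ]ℚ) ≡ toℚ ∣ C ∣
Σℚ-[lookup]≡∣∣ []          = refl
Σℚ-[lookup]≡∣∣ (true ∷ C)  = cong (1ℚ +_) (Σℚ-[lookup]≡∣∣ C)
Σℚ-[lookup]≡∣∣ (false ∷ C) = trans (ℚP.+-identityˡ _) (Σℚ-[lookup]≡∣∣ C)

[∧]≡[]*[] : ∀ a b → [ a ∧ b ]ℚ ≡ [ a ]ℚ * [ b ]ℚ
[∧]≡[]*[] true  true  = refl
[∧]≡[]*[] true  false = refl
[∧]≡[]*[] false true  = refl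
[∧]≡[]*[] false false = refl

Σℚ-Σℚ-[∧]≡∣∣*∣∣ : ∀ {n} {g h : Fin n → Bool} (C E : Subset n) →
  (∀ u → g u ≡ lookup C u) → (∀ v → h v ≡ lookup E v) →
  Σℚ n (λ u → Σℚ n (λ v → [ g u ∧ h v ]ℚ)) ≡ toℚ (∣ C ∣ ℕ.* ∣ E ∣)
Σℚ-Σℚ-[∧]≡∣∣*∣∣ {n} {g} {h} C E g≗C h≗E = begin
  Σℚ n (λ u → Σℚ n (λ v → [ g u ∧ h v ]ℚ))       ≡⟨ Σℚ-cong n (λ u → Σℚ-cong n (λ v → [∧]≡[]*[] (g u) (h v))) ⟩
  Σℚ n (λ u → Σℚ n (λ v → [ g u ]ℚ * [ h v ]ℚ))  ≡⟨ Σℚ-cong n (λ u → Σℚ-*ˡ n [ g u ]ℚ (λ v → [ h v ]ℚ)) ⟩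
  Σℚ n (λ u → [ g u ]ℚ * Σℚ n (λ v → [ h v ]ℚ))  ≡⟨ Σℚ-*ʳ n _ (λ u → [ g u ]ℚ) ⟩
  Σℚ n (λ u → [ g u ]ℚ) * Σℚ n (λ v → [ h v ]ℚ)  ≡⟨ cong₂ _*_ (count C g g≗C) (count E h h≗E) ⟩
  toℚ ∣ C ∣ * toℚ ∣ E ∣                          ≡⟨ sym (toℚ-* ∣ C ∣ ∣ E ∣) ⟩
  toℚ (∣ C ∣ ℕ.* ∣ E ∣)                          ∎
  where
  open ≡-Reasoning
  count : ∀ (C : Subset n) f → (∀ u → f u ≡ lookup C u) → Σℚ n (λ u → [ f u ]ℚ) ≡ toℚ ∣ C ∣
  count C f f≗C = trans (Σℚ-cong n (cong [_]ℚ ∘ f≗C)) (Σℚ-[lookup]≡∣∣ C)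

-- Sides of a split at representatives of four blocks

xor≡false⇒≡ : ∀ a b → a xor b ≡ false → a ≡ b
xor≡false⇒≡ true  true  _ = refl
xor≡false⇒≡ false false _ = refl

sideᵇ : Bool → Bool → Bool
sideᵇ true  a = a
sideᵇ false a = not a

sideᵇ-involutive : ∀ b a → sideᵇ b (sideᵇ b a) ≡ a
sideᵇ-involutive true  a = refl
sideᵇ-involutive false a = not-involutive a

sideᵇ-not : ∀ b a → sideᵇ (not b) a ≡ not (sideᵇ b a)
sideᵇ-not true  a = refl
sideᵇ-not false a = sym (not-involutive a)

sideᵇ-xor : ∀ b x y → sideᵇ b x xor sideᵇ b y ≡ x xor y
sideᵇ-xor true  x y = refl
sideᵇ-xor false x y = trans (sym (not-distribʳ-xor (not x) y))
                            (trans (cong not (sym (not-distribˡ-xor x y))) (not-involutive (x xor y)))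

isolates : Bool → Bool → Bool → Bool
isolates a b c = (a xor b) ∧ not (b xor c)

-- a b c d are the sides of a split at representatives of the blocks TT, TF, FT, FF;
-- corner cuts off TT, diagonal is TT FF | TF FT.
Shape : Set
Shape = Bool → Bool → Bool → Bool → Bool

corner diagonal : Shape
corner   a b c d = isolates a b c ∧ not (b xor d)
diagonal a b c d = isolates a b c ∧ not (a xor d)

[isolates]≡[corner]+[diagonal] : ∀ a b c d → [ isolates a b c ]ℚ ≡ [ corner a b c d ]ℚ + [ diagonal a b c d ]ℚ
[isolates]≡[corner]+[diagonal] true  true  _     _     = refl
[isolates]≡[corner]+[diagonal] false false _     _     = refl
[isolates]≡[corner]+[diagonal] true  false true  _     = refl
[isolates]≡[corner]+[diagonal] false true  false _     = refl
[isolates]≡[corner]+[diagonal] true  false false true  = refl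
[isolates]≡[corner]+[diagonal] true  false false false = refl
[isolates]≡[corner]+[diagonal] false true  true  true  = refl
[isolates]≡[corner]+[diagonal] false true  true  false = refl

diagonal-symmetric : ∀ a b c d →
  diagonal b a d c ≡ diagonal a b c d × diagonal c d a b ≡ diagonal a b c d ×
  diagonal d c b a ≡ diagonal a b c d
diagonal-symmetric true  true  true  true  = refl , refl , refl
diagonal-symmetric true  true  true  false = refl , refl , refl
diagonal-symmetric true  true  false true  = refl , refl , refl
diagonal-symmetric true  true  false false = refl , refl , refl
diagonal-symmetric true  false true  true  = refl , refl , refl
diagonal-symmetric true  false true  false = refl , refl , refl
diagonal-symmetric true  false false true  = refl , refl , refl
diagonal-symmetric true  false false false = refl , refl , refl
diagonal-symmetric false true  true  true  = refl , refl , refl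
diagonal-symmetric false true  true  false = refl , refl , refl
diagonal-symmetric false true  false true  = refl , refl , refl
diagonal-symmetric false true  false false = refl , refl , refl
diagonal-symmetric false false true  true  = refl , refl , refl
diagonal-symmetric false false true  false = refl , refl , refl
diagonal-symmetric false false false true  = refl , refl , refl
diagonal-symmetric false false false false = refl , refl , refl

onValues : Shape → (Bool → Bool → Bool) → Bool
onValues φ π = φ (π true true) (π true false) (π false true) (π false false)

diagonal-side : ∀ b₁ b₂ (π : Bool → Bool → Bool) →
  onValues diagonal (λ c₁ c₂ → π (sideᵇ b₁ c₁) (sideᵇ b₂ c₂)) ≡ onValues diagonal π
diagonal-side true  true  π = refl
diagonal-side true  false π =
  proj₁ (diagonal-symmetric (π true true) (π true false) (π false true) (π false false))
diagonal-side false true  π =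
  proj₁ (proj₂ (diagonal-symmetric (π true true) (π true false) (π false true) (π false false)))
diagonal-side false false π =
  proj₂ (proj₂ (diagonal-symmetric (π true true) (π true false) (π false true) (π false false)))

fromValues : Bool → Bool → Bool → Bool → Bool → Bool → Bool
fromValues a b c d true  true  = a
fromValues a b c d true  false = b
fromValues a b c d false true  = c
fromValues a b c d false false = d

fromValues-eta : (π : Bool → Bool → Bool) (b₁ b₂ : Bool) →
  π b₁ b₂ ≡ fromValues (π true true) (π true false) (π false true) (π false false) b₁ b₂
fromValues-eta π true  true  = refl
fromValues-eta π true  false = refl
fromValues-eta π false true  = refl
fromValues-eta π false false = refl

UpToComplement : (Bool → Bool → Bool) → (Bool → Bool → Bool) → Set
UpToComplement π G = (∀ b₁ b₂ → π b₁ b₂ ≡ G b₁ b₂) ⊎ (∀ b₁ b₂ → π b₁ b₂ ≡ not (G b₁ b₂))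

diagonalᵇ : Bool → Bool → Bool
diagonalᵇ b₁ b₂ = (b₁ ∧ b₂) ∨ (not b₁ ∧ not b₂)

corner-shape : ∀ a b c d → corner a b c d ≡ true → UpToComplement (fromValues a b c d) _∧_
corner-shape true  false false false _ =
  inj₁ λ { true true → refl ; true false → refl ; false true → refl ; false false → refl }
corner-shape false true  true  true  _ =
  inj₂ λ { true true → refl ; true false → refl ; false true → refl ; false false → refl }
corner-shape true  true  _     _     ()
corner-shape false false _     _     ()
corner-shape true  false true  _     ()
corner-shape false true  false _     ()
corner-shape true  false false true  ()
corner-shape false true  true  false ()

diagonal-shape : ∀ a b c d → diagonal a b c d ≡ true → UpToComplement (fromValues a b c d) diagonalᵇ
diagonal-shape true  false false true  _ =
  inj₁ λ { true true → refl ; true false → refl ; false true → refl ; false false → refl }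
diagonal-shape false true  true  false _ =
  inj₂ λ { true true → refl ; true false → refl ; false true → refl ; false false → refl }
diagonal-shape true  true  _     _     ()
diagonal-shape false false _     _     ()
diagonal-shape true  false true  _     ()
diagonal-shape false true  false _     ()
diagonal-shape true  false false false ()
diagonal-shape false true  true  true  ()

lookup-ext : ∀ {n} {A B : Subset n} → (∀ x → lookup A x ≡ lookup B x) → A ≡ B
lookup-ext {A = A} {B} A≗B = trans (sym (tabulate∘lookup A)) (trans (tabulate-cong A≗B) (tabulate∘lookup B))

side : ∀ {n} → Bool → Subset n → Subset n
side true  A = A
side false A = ∁ A

lookup-side : ∀ {n} b (A : Subset n) x → lookup (side b A) x ≡ sideᵇ b (lookup A x)
lookup-side true  A x = refl
lookup-side false A x = lookup-map x not A

∈-side⇒lookup : ∀ {n} b (A : Subset n) {x} → x ∈ side b A → lookup A x ≡ b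
∈-side⇒lookup true  A     x∈A  = []=⇒lookup x∈A
∈-side⇒lookup false A {x} x∈∁A = ¬-not (x∈∁p⇒x∉p x∈∁A ∘ lookup⇒[]= x A)

nonempty⇒∣∣>0 : ∀ {n} {A : Subset n} → Nonempty A → 0 ℕ.< ∣ A ∣
nonempty⇒∣∣>0 (x , x∈A) = ℕP.≤-<-trans ℕ.z≤n (x∈p⇒∣p-x∣<∣p∣ x∈A)

properᵇ-intro : ∀ {n} (A : Subset n) {u v} → lookup A u ≡ true → lookup A v ≡ false → properᵇ A ≡ true
properᵇ-intro (true  ∷ A) {v = suc v} _    A[v] = true∷ A v A[v]
  where
  true∷ : ∀ {n} (A : Subset n) v → lookup A v ≡ false → properᵇ (true ∷ A) ≡ true
  true∷ (false ∷ A) _       _    = refl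
  true∷ (true  ∷ A) (suc v) A[v] = true∷ A v A[v]
properᵇ-intro (false ∷ A) {u = suc u} A[u] _    = false∷ A u A[u]
  where
  false∷ : ∀ {n} (A : Subset n) u → lookup A u ≡ true → properᵇ (false ∷ A) ≡ true
  false∷ (true  ∷ A) _       _    = refl
  false∷ (false ∷ A) (suc u) A[u] = false∷ A u A[u]

≢⇒≠ᵇ : ∀ {n} {u v : Fin n} → u ≢ v → (u ≠ᵇ v) ≡ true
≢⇒≠ᵇ {u = u} {v} u≢v = cong not (dec-false (toℕ u ℕ.≟ toℕ v) (u≢v ∘ toℕ-injective))

record Representatives {n} (f g : Fin n → Bool) : Set where
  field
    pt   : Bool → Bool → Fin n
    f-pt : ∀ b₁ b₂ → f (pt b₁ b₂) ≡ b₁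
    g-pt : ∀ b₁ b₂ → g (pt b₁ b₂) ≡ b₂

module _ {n : ℕ} {A₁ A₂ : Subset n} (incompatible : Incompatible A₁ A₂) where

  incompatible⇒quadrants : ∀ b₁ b₂ → Nonempty (side b₁ A₁ ∩ side b₂ A₂)
  incompatible⇒quadrants true  true  = proj₁ incompatible
  incompatible⇒quadrants true  false = proj₁ (proj₂ incompatible)
  incompatible⇒quadrants false true  = proj₁ (proj₂ (proj₂ incompatible))
  incompatible⇒quadrants false false = proj₂ (proj₂ (proj₂ incompatible))

  incompatible⇒representatives : Representatives (lookup A₁) (lookup A₂)
  incompatible⇒representatives = record
    { pt   = λ b₁ b₂ → proj₁ (incompatible⇒quadrants b₁ b₂)
    ; f-pt = λ b₁ b₂ → ∈-side⇒lookup b₁ A₁ (proj₁ (x∈p∩q⁻ _ _ (proj₂ (incompatible⇒quadrants b₁ b₂))))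
    ; g-pt = λ b₁ b₂ → ∈-side⇒lookup b₂ A₂ (proj₂ (x∈p∩q⁻ _ _ (proj₂ (incompatible⇒quadrants b₁ b₂))))
    }

-- Gromov products, two-split distances and O

-- twice the Gromov product (y|z)ₓ
gromov : ∀ {n} → Dist n → Fin n → Fin n → Fin n → ℚ
gromov D x y z = D x y + D x z - D y z

module _ {n : ℕ} where

  gromov-cong : ∀ {D D' : Dist n} → (∀ x y → D x y ≡ D' x y) → ∀ x y z → gromov D x y z ≡ gromov D' x y z
  gromov-cong D≗D' x y z = cong₂ _-_ (cong₂ _+_ (D≗D' x y) (D≗D' x z)) (D≗D' y z)

  gromov-* : ∀ c (D : Dist n) x y z → gromov (λ a b → c * D a b) x y z ≡ c * gromov D x y z
  gromov-* c D x y z =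
    solve 4 (λ c a b d → c :* a :+ c :* b :- c :* d := c :* (a :+ b :- d)) refl c (D x y) (D x z) (D y z)

  gromov-Σℚ : ∀ m (D : Fin m → Dist n) x y z →
    gromov (λ a b → Σℚ m (λ k → D k a b)) x y z ≡ Σℚ m (λ k → gromov (D k) x y z)
  gromov-Σℚ zero    D x y z = refl
  gromov-Σℚ (suc m) D x y z =
    trans (regroup (D zero x y) (D zero x z) (D zero y z) _ _ _)
          (cong (gromov (D zero) x y z +_) (gromov-Σℚ m (D ∘ suc) x y z))
    where
    regroup : ∀ a b c d e f → (a + d) + (b + e) - (c + f) ≡ (a + b - c) + (d + e - f)
    regroup = solve 6 (λ a b c d e f → (a :+ d) :+ (b :+ e) :- (c :+ f) := (a :+ b :- c) :+ (d :+ e :- f)) refl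

  gromov-D[] : ∀ (A : Subset n) x y z →
    gromov D[ A ] x y z ≡ two * [ isolates (lookup A x) (lookup A y) (lookup A z) ]ℚ
  gromov-D[] A x y z = gromov-xor (lookup A x) (lookup A y) (lookup A z)
    where
    gromov-xor : ∀ a b c → [ a xor b ]ℚ + [ a xor c ]ℚ - [ b xor c ]ℚ ≡ two * [ isolates a b c ]ℚ
    gromov-xor true  true  true  = refl
    gromov-xor true  true  false = refl
    gromov-xor true  false true  = refl
    gromov-xor true  false false = refl
    gromov-xor false true  true  = refl
    gromov-xor false true  false = refl
    gromov-xor false false true  = refl
    gromov-xor false false false = refl

  gromov-D⟨⟩ : ∀ {m} (S : SplitSystem n m) (ω : Fin m → ℚ) x y z →
    gromov D⟨ S , ω ⟩ x y z
    ≡ two * Σℚ m (λ k → ω k * [ isolates (lookup (S k) x) (lookup (S k) y) (lookup (S k) z) ]ℚ)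
  gromov-D⟨⟩ {m} S ω x y z = begin
    gromov D⟨ S , ω ⟩ x y z
      ≡⟨ gromov-Σℚ m (λ k a b → ω k * D[ S k ] a b) x y z ⟩
    Σℚ m (λ k → gromov (λ a b → ω k * D[ S k ] a b) x y z)
      ≡⟨ Σℚ-cong m (λ k → gromov-* (ω k) D[ S k ] x y z) ⟩
    Σℚ m (λ k → ω k * gromov D[ S k ] x y z)
      ≡⟨ Σℚ-cong m (λ k → cong (ω k *_) (gromov-D[] (S k) x y z)) ⟩
    Σℚ m (λ k → ω k * (two * [ sep k ]ℚ))
      ≡⟨ Σℚ-cong m (λ k → swap (ω k) [ sep k ]ℚ) ⟩
    Σℚ m (λ k → two * (ω k * [ sep k ]ℚ))
      ≡⟨ Σℚ-*ˡ m two (λ k → ω k * [ sep k ]ℚ) ⟩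
    two * Σℚ m (λ k → ω k * [ sep k ]ℚ)
      ∎
    where
    open ≡-Reasoning
    sep : Fin m → Bool
    sep k = isolates (lookup (S k) x) (lookup (S k) y) (lookup (S k) z)
    swap : ∀ w b → w * (two * b) ≡ two * (w * b)
    swap w b = solve 3 (λ w t b → w :* (t :* b) := t :* (w :* b)) refl w two b

D[]-vanishes : ∀ {n} (A : Subset n) {x y} → lookup A x ≡ lookup A y → D[ A ] x y ≡ 0ℚ
D[]-vanishes A {x} {y} A[x]≡A[y] =
  cong [_]ℚ (trans (cong (_xor lookup A y) A[x]≡A[y]) (xor-same (lookup A y)))

D⟨⟩-unseparated : ∀ {n m} (S : SplitSystem n m) {ω : Fin m → ℚ} → NonNeg ω →
  ∀ {x y} → D⟨ S , ω ⟩ x y ≡ 0ℚ → ∀ {k} → 0ℚ < ω k → lookup (S k) x ≡ lookup (S k) y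
D⟨⟩-unseparated {m = m} S {ω} ω≥0 {x} {y} D≡0 {k} ωk>0 =
  xor≡false⇒≡ _ _ (*[]≡0 (separates k) ωk>0 (Σℚ-nonneg-≡0 m (λ l → *[]-nonneg (ω≥0 l) (separates l)) D≡0 k))
  where
  separates : Fin m → Bool
  separates l = lookup (S l) x xor lookup (S l) y

hamming : Bool → Bool → Bool → Bool → ℚ
hamming a₁ a₂ b₁ b₂ = [ a₁ xor b₁ ]ℚ + [ a₂ xor b₂ ]ℚ

TwoSplit : ∀ {n} → Dist n → (Fin n → Bool) → (Fin n → Bool) → Set
TwoSplit D f g = ∀ x y → D x y ≡ hamming (f x) (g x) (f y) (g y)

module _ {n : ℕ} {f g : Fin n → Bool} (b₁ b₂ : Bool) where

  TwoSplit-side : ∀ {D} → TwoSplit D f g → TwoSplit D (sideᵇ b₁ ∘ f) (sideᵇ b₂ ∘ g)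
  TwoSplit-side D≡ x y =
    trans (D≡ x y) (sym (cong₂ (λ a b → [ a ]ℚ + [ b ]ℚ) (sideᵇ-xor b₁ (f x) (f y)) (sideᵇ-xor b₂ (g x) (g y))))

  Representatives-side : Representatives f g → Representatives (sideᵇ b₁ ∘ f) (sideᵇ b₂ ∘ g)
  Representatives-side reps = record
    { pt   = λ c₁ c₂ → pt (sideᵇ b₁ c₁) (sideᵇ b₂ c₂)
    ; f-pt = λ c₁ c₂ → trans (cong (sideᵇ b₁) (f-pt _ _)) (sideᵇ-involutive b₁ c₁)
    ; g-pt = λ c₁ c₂ → trans (cong (sideᵇ b₂) (g-pt _ _)) (sideᵇ-involutive b₂ c₂)
    }
    where open Representatives reps

D⟨𝟙+𝟙⟩-twoSplit : ∀ {n m} (S : SplitSystem n m) i j →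
  TwoSplit D⟨ S , (λ k → 𝟙 i k + 𝟙 j k) ⟩ (lookup (S i)) (lookup (S j))
D⟨𝟙+𝟙⟩-twoSplit {m = m} S i j x y =
  trans (Σℚ-cong m (λ k → ℚP.*-distribʳ-+ (D[ S k ] x y) (𝟙 i k) (𝟙 j k)))
        (trans (Σℚ-+ m _ _) (cong₂ _+_ (Σℚ-𝟙 m i (λ k → D[ S k ] x y)) (Σℚ-𝟙 m j (λ k → D[ S k ] x y))))

-- w ∈ X_{u,v} for a two-split distance, with u v w given by their coordinates
closerᵇ : (u₁ u₂ v₁ v₂ w₁ w₂ : Bool) → Bool
closerᵇ u₁ u₂ v₁ v₂ w₁ w₂ = not (hamming v₁ v₂ w₁ w₂ ≤ᵇ hamming u₁ u₂ w₁ w₂)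

isolates-closer : ∀ u₁ u₂ v₁ v₂ →
  isolates (closerᵇ u₁ u₂ v₁ v₂ true true) (closerᵇ u₁ u₂ v₁ v₂ true false) (closerᵇ u₁ u₂ v₁ v₂ false true)
  ≡ (u₁ ∧ u₂) ∧ (not v₁ ∧ not v₂)
isolates-closer true  true  true  true  = refl
isolates-closer true  true  true  false = refl
isolates-closer true  true  false true  = refl
isolates-closer true  true  false false = refl
isolates-closer true  false true  true  = refl
isolates-closer true  false true  false = refl
isolates-closer true  false false true  = refl
isolates-closer true  false false false = refl
isolates-closer false true  true  true  = refl
isolates-closer false true  true  false = refl
isolates-closer false true  false true  = refl
isolates-closer false true  false false = refl
isolates-closer false false true  true  = refl
isolates-closer false false true  false = refl
isolates-closer false false false true  = refl
isolates-closer false false false false = refl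

closer-antipodal : ∀ {a b c d} → a ≡ true → b ≡ true → c ≡ false → d ≡ false →
  closerᵇ a b c d a b ≡ true × closerᵇ a b c d c d ≡ false
closer-antipodal refl refl refl refl = refl , refl

antipodalᵇ : ∀ {n} → (Fin n → Bool) → (Fin n → Bool) → Fin n → Fin n → Bool
antipodalᵇ f g u v = (f u ∧ g u) ∧ (not (f v) ∧ not (g v))

antipodal-values : ∀ a b c d → (a ∧ b) ∧ (not c ∧ not d) ≡ true → a ≡ true × b ≡ true × c ≡ false × d ≡ false
antipodal-values true  true  false false _ = refl , refl , refl , refl
antipodal-values false _     _     _     ()
antipodal-values true  false _     _     ()
antipodal-values true  true  true  _     ()
antipodal-values true  true  false true  ()

Osummand : ∀ {n} → Dist n → Fin n → Fin n → Dist n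
Osummand D u v x y = [ (u ≠ᵇ v) ∧ properᵇ (Xuv D u v) ]ℚ * ((two * ½) * D[ Xuv D u v ] x y)

-- q - p/2 = 0 kills the second sum of O.
O-first-sum : ∀ {n} (D : Dist n) x y → O two 1ℚ D x y ≡ Σℚ n (λ u → Σℚ n (λ v → Osummand D u v x y))
O-first-sum {n} D x y =
  trans (cong (first +_) (Σℚ-zero n (λ u → Σℚ-zero n (λ v → vanishes u v)))) (ℚP.+-identityʳ first)
  where
  vanishes : ∀ u v → [ (u <ᵇF v) ∧ properᵇ (Euv D u v) ]ℚ * ((1ℚ - two * ½) * D[ Euv D u v ] x y) ≡ 0ℚ
  vanishes u v = trans (cong ([ (u <ᵇF v) ∧ properᵇ (Euv D u v) ]ℚ *_) (ℚP.*-zeroˡ (D[ Euv D u v ] x y)))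
                       (ℚP.*-zeroʳ [ (u <ᵇF v) ∧ properᵇ (Euv D u v) ]ℚ)
  first : ℚ
  first = Σℚ n (λ u → Σℚ n (λ v → Osummand D u v x y))

module _ {n : ℕ} {D : Dist n} {f g : Fin n → Bool} (D≡ : TwoSplit D f g) where

  lookup-Xuv : ∀ u v w → lookup (Xuv D u v) w ≡ closerᵇ (f u) (g u) (f v) (g v) (f w) (g w)
  lookup-Xuv u v w = trans (lookup∘tabulate _ w) (cong₂ (λ a b → not (a ≤ᵇ b)) (D≡ v w) (D≡ u w))

  O-vanishes-on-blocks : ∀ {x y} → f x ≡ f y → g x ≡ g y → O two 1ℚ D x y ≡ 0ℚ
  O-vanishes-on-blocks {x} {y} fx≡fy gx≡gy =
    trans (O-first-sum D x y) (Σℚ-zero n (λ u → Σℚ-zero n (λ v → summand-vanishes u v)))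
    where
    summand-vanishes : ∀ u v → Osummand D u v x y ≡ 0ℚ
    summand-vanishes u v = begin
      c * ((two * ½) * D[ X ] x y) ≡⟨ cong (λ d → c * ((two * ½) * d)) (D[]-vanishes X X[x]≡X[y]) ⟩
      c * ((two * ½) * 0ℚ)         ≡⟨ cong (c *_) (ℚP.*-zeroʳ (two * ½)) ⟩
      c * 0ℚ                       ≡⟨ ℚP.*-zeroʳ c ⟩
      0ℚ                           ∎
      where
      open ≡-Reasoning
      X = Xuv D u v
      c = [ (u ≠ᵇ v) ∧ properᵇ X ]ℚ
      X[x]≡X[y] : lookup X x ≡ lookup X y
      X[x]≡X[y] = trans (lookup-Xuv u v x)
                        (trans (cong₂ (closerᵇ (f u) (g u) (f v) (g v)) fx≡fy gx≡gy) (sym (lookup-Xuv u v y)))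

  antipodal⇒contributes : ∀ {u v} → antipodalᵇ f g u v ≡ true → ((u ≠ᵇ v) ∧ properᵇ (Xuv D u v)) ≡ true
  antipodal⇒contributes {u} {v} uv = contributes (antipodal-values (f u) (g u) (f v) (g v) uv)
    where
    contributes : f u ≡ true × g u ≡ true × f v ≡ false × g v ≡ false → ((u ≠ᵇ v) ∧ properᵇ (Xuv D u v)) ≡ true
    contributes (fu , gu , fv , gv) = cong₂ _∧_ (≢⇒≠ᵇ u≢v) (properᵇ-intro (Xuv D u v) X[u] X[v])
      where
      u≢v : u ≢ v
      u≢v u≡v with () ← trans (sym fu) (trans (cong f u≡v) fv)
      X[u] : lookup (Xuv D u v) u ≡ true
      X[u] = trans (lookup-Xuv u v u) (proj₁ (closer-antipodal fu gu fv gv))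
      X[v] : lookup (Xuv D u v) v ≡ false
      X[v] = trans (lookup-Xuv u v v) (proj₂ (closer-antipodal fu gu fv gv))

  module _ (reps : Representatives f g) where
    open Representatives reps

    gromov-O : gromov (O two 1ℚ D) (pt true true) (pt true false) (pt false true)
               ≡ two * Σℚ n (λ u → Σℚ n (λ v → [ antipodalᵇ f g u v ]ℚ))
    gromov-O = begin
      gromov (O two 1ℚ D) p q r
        ≡⟨ gromov-cong (O-first-sum D) p q r ⟩
      gromov (λ x y → Σℚ n (λ u → Σℚ n (λ v → Osummand D u v x y))) p q r
        ≡⟨ gromov-Σℚ n (λ u x y → Σℚ n (λ v → Osummand D u v x y)) p q r ⟩
      Σℚ n (λ u → gromov (λ x y → Σℚ n (λ v → Osummand D u v x y)) p q r)
        ≡⟨ Σℚ-cong n (λ u → gromov-Σℚ n (Osummand D u) p q r) ⟩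
      Σℚ n (λ u → Σℚ n (λ v → gromov (Osummand D u v) p q r))
        ≡⟨ Σℚ-cong n (λ u → Σℚ-cong n (gromov-Osummand u)) ⟩
      Σℚ n (λ u → Σℚ n (λ v → two * [ antipodalᵇ f g u v ]ℚ))
        ≡⟨ Σℚ-cong n (λ u → Σℚ-*ˡ n two _) ⟩
      Σℚ n (λ u → two * Σℚ n (λ v → [ antipodalᵇ f g u v ]ℚ))
        ≡⟨ Σℚ-*ˡ n two _ ⟩
      two * Σℚ n (λ u → Σℚ n (λ v → [ antipodalᵇ f g u v ]ℚ))
        ∎
      where
      open ≡-Reasoning
      p = pt true true
      q = pt true false
      r = pt false true

      gromov-Osummand : ∀ u v → gromov (Osummand D u v) p q r ≡ two * [ antipodalᵇ f g u v ]ℚ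
      gromov-Osummand u v = begin
        gromov (Osummand D u v) p q r                     ≡⟨ gromov-* c (λ x y → (two * ½) * D[ X ] x y) p q r ⟩
        c * gromov (λ x y → (two * ½) * D[ X ] x y) p q r ≡⟨ cong (c *_) (gromov-* (two * ½) D[ X ] p q r) ⟩
        c * ((two * ½) * gromov D[ X ] p q r)             ≡⟨ cong (c *_) (ℚP.*-identityˡ _) ⟩
        c * gromov D[ X ] p q r                           ≡⟨ cong (c *_) (gromov-D[] X p q r) ⟩
        c * (two * [ isolates X[ p ] X[ q ] X[ r ] ]ℚ)    ≡⟨ cong (λ b → c * (two * [ b ]ℚ)) X-isolates ⟩
        c * (two * [ antipodalᵇ f g u v ]ℚ)                ≡⟨ []*-absorbs two antipodal⇒contributes ⟩
        two * [ antipodalᵇ f g u v ]ℚ                      ∎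
        where
        X = Xuv D u v
        c = [ (u ≠ᵇ v) ∧ properᵇ X ]ℚ
        X[_] : Fin n → Bool
        X[ w ] = lookup X w
        closer : Bool → Bool → Bool
        closer = closerᵇ (f u) (g u) (f v) (g v)
        X-at : ∀ b₁ b₂ → X[ pt b₁ b₂ ] ≡ closer b₁ b₂
        X-at b₁ b₂ = trans (lookup-Xuv u v (pt b₁ b₂)) (cong₂ closer (f-pt b₁ b₂) (g-pt b₁ b₂))
        X-isolates : isolates X[ p ] X[ q ] X[ r ] ≡ antipodalᵇ f g u v
        X-isolates = trans (cong₂ (λ a b → isolates a b X[ r ]) (X-at true true) (X-at true false))
                    (trans (cong (isolates (closer true true) (closer true false)) (X-at false true))
                           (isolates-closer (f u) (g u) (f v) (g v)))

weight : ∀ {n m} → SplitSystem n m → (Fin m → ℚ) → (Bool → Bool → Fin n) → Shape → ℚ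
weight {m = m} S ω pt φ = Σℚ m (λ k → ω k * [ onValues φ (λ c₁ c₂ → lookup (S k) (pt c₁ c₂)) ]ℚ)

weight-nonneg : ∀ {n m} (S : SplitSystem n m) {ω} → NonNeg ω → ∀ pt φ → 0ℚ ≤ℚ weight S ω pt φ
weight-nonneg {m = m} S ω≥0 pt φ =
  Σℚ-nonneg m (λ k → *[]-nonneg (ω≥0 k) (onValues φ (λ c₁ c₂ → lookup (S k) (pt c₁ c₂))))

diagonal-weight-side : ∀ {n m} (S : SplitSystem n m) ω pt b₁ b₂ →
  weight S ω (λ c₁ c₂ → pt (sideᵇ b₁ c₁) (sideᵇ b₂ c₂)) diagonal ≡ weight S ω pt diagonal
diagonal-weight-side {m = m} S ω pt b₁ b₂ =
  Σℚ-cong m (λ k → cong (λ b → ω k * [ b ]ℚ) (diagonal-side b₁ b₂ (λ c₁ c₂ → lookup (S k) (pt c₁ c₂))))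

-- Everything is relative to the block TT of (f, g); the other three blocks are reached by
-- relabelling sides with sideᵇ.
module Corner {n m : ℕ} (S : SplitSystem n m) {ω : Fin m → ℚ} (ω≥0 : NonNeg ω)
  {D : Dist n} (O≡D⟨S,ω⟩ : ∀ x y → O two 1ℚ D x y ≡ D⟨ S , ω ⟩ x y)
  {f g : Fin n → Bool} (D≡ : TwoSplit D f g) (reps : Representatives f g) where

  open Representatives reps

  at : Fin m → Bool → Bool → Bool
  at k c₁ c₂ = lookup (S k) (pt c₁ c₂)

  positive-split-on-blocks : ∀ {k} → 0ℚ < ω k → ∀ x →
    lookup (S k) x
    ≡ fromValues (at k true true) (at k true false) (at k false true) (at k false false) (f x) (g x)
  positive-split-on-blocks {k} ωk>0 x =
    trans (D⟨⟩-unseparated S ω≥0 D⟨x,x̂⟩≡0 ωk>0) (fromValues-eta (at k) (f x) (g x))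
    where
    D⟨x,x̂⟩≡0 : D⟨ S , ω ⟩ x (pt (f x) (g x)) ≡ 0ℚ
    D⟨x,x̂⟩≡0 = trans (sym (O≡D⟨S,ω⟩ x _))
                     (O-vanishes-on-blocks {f = f} {g} D≡ (sym (f-pt (f x) (g x))) (sym (g-pt (f x) (g x))))

  antipodal-count :
    Σℚ n (λ u → Σℚ n (λ v → [ antipodalᵇ f g u v ]ℚ)) ≡ weight S ω pt corner + weight S ω pt diagonal
  antipodal-count = two*-injective (begin
    two * Σℚ n (λ u → Σℚ n (λ v → [ antipodalᵇ f g u v ]ℚ)) ≡⟨ sym (gromov-O D≡ reps) ⟩
    gromov (O two 1ℚ D) p q r                               ≡⟨ gromov-cong O≡D⟨S,ω⟩ p q r ⟩
    gromov D⟨ S , ω ⟩ p q r                                 ≡⟨ gromov-D⟨⟩ S ω p q r ⟩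
    two * Σℚ m (λ k → ω k * [ isolates (at k true true) (at k true false) (at k false true) ]ℚ)
      ≡⟨ cong (two *_) (trans (Σℚ-cong m split) (Σℚ-+ m (weighted corner) (weighted diagonal))) ⟩
    two * (weight S ω pt corner + weight S ω pt diagonal)  ∎)
    where
    open ≡-Reasoning
    p = pt true true
    q = pt true false
    r = pt false true
    weighted : Shape → Fin m → ℚ
    weighted φ k = ω k * [ onValues φ (at k) ]ℚ
    split : ∀ k → ω k * [ isolates (at k true true) (at k true false) (at k false true) ]ℚ
                ≡ weighted corner k + weighted diagonal k
    split k =
      trans (cong (ω k *_) ([isolates]≡[corner]+[diagonal] (at k true true) (at k true false)
                                                          (at k false true) (at k false false)))
            (ℚP.*-distribˡ-+ (ω k) _ _)

  contains : ∀ {φ G} → (∀ a b c d → φ a b c d ≡ true → UpToComplement (fromValues a b c d) G) →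
             0ℚ < weight S ω pt φ → (C : Subset n) → (∀ x → lookup C x ≡ G (f x) (g x)) → Contains S C
  contains φ-shape w>0 C C≗G with Σℚ-pos⇒∃ m w>0
  ... | k , term>0 with *[]-pos _ term>0
  ... | ωk>0 , φ[k] with φ-shape _ _ _ _ φ[k]
  ... | inj₁ same     = k , inj₁ (lookup-ext λ x →
          trans (positive-split-on-blocks ωk>0 x) (trans (same (f x) (g x)) (sym (C≗G x))))
  ... | inj₂ opposite = k , inj₂ (lookup-ext λ x →
          trans (positive-split-on-blocks ωk>0 x) (trans (opposite (f x) (g x))
                (trans (cong not (sym (C≗G x))) (sym (lookup-map x not C)))))

-- Closure

-- The numerical content of the closure conditions (a), (b), (c), (d).
CornerCases : (P Q : ℕ) (wTT wFT wTF wFF d : ℚ) → Set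
CornerCases P Q wTT wFT wTF wFF d =
  (0ℚ < wTT × 0ℚ < wFT × 0ℚ < wTF × 0ℚ < wFF) ⊎
  (0ℚ < d × (P ≡ Q ⊎ (Q ℕ.< P × 0ℚ < wTT × 0ℚ < wFF) ⊎ (P ℕ.< Q × 0ℚ < wFT × 0ℚ < wTF)))

corner-weights-trichotomy : ∀ {P Q : ℕ} {wTT wFT wTF wFF d : ℚ} →
  0 ℕ.< P → 0 ℕ.< Q → 0ℚ ≤ℚ wTT → 0ℚ ≤ℚ wTF →
  toℚ P ≡ wTT + d → toℚ P ≡ wFF + d → toℚ Q ≡ wTF + d → toℚ Q ≡ wFT + d →
  CornerCases P Q wTT wFT wTF wFF d
corner-weights-trichotomy {P} {Q} {d = d} P>0 Q>0 wTT≥0 wTF≥0 eTT eFF eTF eFT with 0ℚ <? d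
... | no d≯0 =
  inj₁ (summand-pos eTT (d< P>0) , summand-pos eFT (d< Q>0) ,
        summand-pos eTF (d< Q>0) , summand-pos eFF (d< P>0))
  where
  d< : ∀ {a} → 0 ℕ.< a → d < toℚ a
  d< a>0 = ℚP.≤-<-trans (ℚP.≮⇒≥ d≯0) (toℚ-mono-< a>0)
... | yes d>0 with ℕP.<-cmp P Q
...   | tri≈ _ P≡Q _ = inj₂ (d>0 , inj₁ P≡Q)
...   | tri> _ _ Q<P = inj₂ (d>0 , inj₂ (inj₁ (Q<P , summand-pos eTT d<P , summand-pos eFF d<P)))
  where
  d<P : d < toℚ P
  d<P = ℚP.≤-<-trans (summand-bound eTF wTF≥0) (toℚ-mono-< Q<P)
...   | tri< P<Q _ _ = inj₂ (d>0 , inj₂ (inj₂ (P<Q , summand-pos eFT d<Q , summand-pos eTF d<Q)))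
  where
  d<Q : d < toℚ Q
  d<Q = ℚP.≤-<-trans (summand-bound eTT wTT≥0) (toℚ-mono-< P<Q)

module IncompatiblePair {n m : ℕ} (S : SplitSystem n m) {ω : Fin m → ℚ} (ω≥0 : NonNeg ω) {i j : Fin m}
  (O≡D⟨S,ω⟩ : ∀ x y → O two 1ℚ D⟨ S , (λ k → 𝟙 i k + 𝟙 j k) ⟩ x y ≡ D⟨ S , ω ⟩ x y)
  (incompatible : Incompatible (S i) (S j)) where

  a₁ a₂ : Fin n → Bool
  a₁ = lookup (S i)
  a₂ = lookup (S j)

  reps : Representatives a₁ a₂
  reps = incompatible⇒representatives incompatible
  open Representatives reps

  module Quadrant (b₁ b₂ : Bool) =
    Corner S ω≥0 O≡D⟨S,ω⟩ (TwoSplit-side b₁ b₂ (D⟨𝟙+𝟙⟩-twoSplit S i j)) (Representatives-side b₁ b₂ reps)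

  quadrant : Bool → Bool → Subset n
  quadrant b₁ b₂ = side b₁ (S i) ∩ side b₂ (S j)

  lookup-quadrant : ∀ b₁ b₂ x → lookup (quadrant b₁ b₂) x ≡ sideᵇ b₁ (a₁ x) ∧ sideᵇ b₂ (a₂ x)
  lookup-quadrant b₁ b₂ x = trans (lookup-zipWith _∧_ x (side b₁ (S i)) (side b₂ (S j)))
                                  (cong₂ _∧_ (lookup-side b₁ (S i) x) (lookup-side b₂ (S j) x))

  pt-side : Bool → Bool → Bool → Bool → Fin n
  pt-side b₁ b₂ c₁ c₂ = pt (sideᵇ b₁ c₁) (sideᵇ b₂ c₂)

  cornerWeight : Bool → Bool → ℚ
  cornerWeight b₁ b₂ = weight S ω (pt-side b₁ b₂) corner

  diagonalWeight : ℚ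
  diagonalWeight = weight S ω pt diagonal

  corner-equation : ∀ b₁ b₂ →
    toℚ (∣ quadrant b₁ b₂ ∣ ℕ.* ∣ quadrant (not b₁) (not b₂) ∣) ≡ cornerWeight b₁ b₂ + diagonalWeight
  corner-equation b₁ b₂ = begin
    toℚ (∣ quadrant b₁ b₂ ∣ ℕ.* ∣ quadrant (not b₁) (not b₂) ∣)
      ≡⟨ sym (Σℚ-Σℚ-[∧]≡∣∣*∣∣ (quadrant b₁ b₂) (quadrant (not b₁) (not b₂))
                              (sym ∘ lookup-quadrant b₁ b₂) opposite) ⟩
    Σℚ n (λ u → Σℚ n (λ v → [ antipodalᵇ (sideᵇ b₁ ∘ a₁) (sideᵇ b₂ ∘ a₂) u v ]ℚ))
      ≡⟨ Quadrant.antipodal-count b₁ b₂ ⟩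
    cornerWeight b₁ b₂ + weight S ω (pt-side b₁ b₂) diagonal
      ≡⟨ cong (cornerWeight b₁ b₂ +_) (diagonal-weight-side S ω pt b₁ b₂) ⟩
    cornerWeight b₁ b₂ + diagonalWeight
      ∎
    where
    open ≡-Reasoning
    opposite : ∀ v → (not (sideᵇ b₁ (a₁ v)) ∧ not (sideᵇ b₂ (a₂ v))) ≡ lookup (quadrant (not b₁) (not b₂)) v
    opposite v = sym (trans (lookup-quadrant (not b₁) (not b₂) v)
                            (cong₂ _∧_ (sideᵇ-not b₁ (a₁ v)) (sideᵇ-not b₂ (a₂ v))))

  corner-contained : ∀ b₁ b₂ → 0ℚ < cornerWeight b₁ b₂ → Contains S (quadrant b₁ b₂)
  corner-contained b₁ b₂ w>0 = Quadrant.contains b₁ b₂ corner-shape w>0 (quadrant b₁ b₂) (lookup-quadrant b₁ b₂)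

  diagonal-contained : 0ℚ < diagonalWeight → Contains S (quadrant true true ∪ quadrant false false)
  diagonal-contained w>0 = Quadrant.contains true true diagonal-shape w>0 _ λ x →
    trans (lookup-zipWith _∨_ x (quadrant true true) (quadrant false false))
          (cong₂ _∨_ (lookup-quadrant true true x) (lookup-quadrant false false x))

  products-pos : ∀ b₁ b₂ → 0 ℕ.< ∣ quadrant b₁ b₂ ∣ ℕ.* ∣ quadrant (not b₁) (not b₂) ∣
  products-pos b₁ b₂ = ℕP.*-mono-< (nonempty⇒∣∣>0 (incompatible⇒quadrants incompatible b₁ b₂))
                                    (nonempty⇒∣∣>0 (incompatible⇒quadrants incompatible (not b₁) (not b₂)))

  corner-equation-swapped : ∀ b₁ b₂ →
    toℚ (∣ quadrant (not b₁) (not b₂) ∣ ℕ.* ∣ quadrant b₁ b₂ ∣) ≡ cornerWeight b₁ b₂ + diagonalWeight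
  corner-equation-swapped b₁ b₂ =
    trans (cong toℚ (ℕP.*-comm ∣ quadrant (not b₁) (not b₂) ∣ ∣ quadrant b₁ b₂ ∣)) (corner-equation b₁ b₂)

  P Q : ℕ
  P = ∣ quadrant true true ∣ ℕ.* ∣ quadrant false false ∣
  Q = ∣ quadrant true false ∣ ℕ.* ∣ quadrant false true ∣

  closure-condition-of : CornerCases P Q (cornerWeight true true) (cornerWeight false true)
                           (cornerWeight true false) (cornerWeight false false) diagonalWeight →
                         CondA S (S i) (S j) ⊎ CondB S (S i) (S j) ⊎ CondC S (S i) (S j) ⊎ CondD S (S i) (S j)
  closure-condition-of (inj₁ (wTT , wFT , wTF , wFF)) =
    inj₁ (corner-contained true true wTT , corner-contained false true wFT ,
          corner-contained true false wTF , corner-contained false false wFF)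
  closure-condition-of (inj₂ (d>0 , inj₁ P≡Q)) =
    inj₂ (inj₁ (P≡Q , diagonal-contained d>0))
  closure-condition-of (inj₂ (d>0 , inj₂ (inj₁ (Q<P , wTT , wFF)))) =
    inj₂ (inj₂ (inj₁ (Q<P , diagonal-contained d>0 ,
                      corner-contained true true wTT , corner-contained false false wFF)))
  closure-condition-of (inj₂ (d>0 , inj₂ (inj₂ (P<Q , wFT , wTF)))) =
    inj₂ (inj₂ (inj₂ (P<Q , diagonal-contained d>0 ,
                      corner-contained false true wFT , corner-contained true false wTF)))

  closure-condition : CondA S (S i) (S j) ⊎ CondB S (S i) (S j) ⊎ CondC S (S i) (S j) ⊎ CondD S (S i) (S j)
  closure-condition = closure-condition-of (corner-weights-trichotomy
    (products-pos true true) (products-pos true false)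
    (weight-nonneg S ω≥0 (pt-side true true) corner) (weight-nonneg S ω≥0 (pt-side true false) corner)
    (corner-equation true true) (corner-equation-swapped false false)
    (corner-equation true false) (corner-equation-swapped false true))

𝟙+𝟙-nonneg : ∀ {m} (i j : Fin m) → NonNeg (λ k → 𝟙 i k + 𝟙 j k)
𝟙+𝟙-nonneg i j k = ℚP.+-mono-≤ ([]-nonneg (does (k ≟F i))) ([]-nonneg (does (k ≟F j)))

lemma2 : (n m : ℕ) → 4 ≤ n → (S : SplitSystem n m) → IsSplitSystem S →
         LinearlyIndependent S → Orderly S → Closed S
lemma2 n m _ S _ _ orderly i j incompatible =
  let ω , ω≥0 , O≡D⟨S,ω⟩ = orderly two 1ℚ refl 0<1 (λ k → 𝟙 i k + 𝟙 j k) (𝟙+𝟙-nonneg i j)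
  in  IncompatiblePair.closure-condition S ω≥0 O≡D⟨S,ω⟩ incompatible
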